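{- Up to logical equivalence, the following hold: (1) $\mathcal L_{rs}\supseteq\mathcal L_{\mathsf{iocos}}$; (2) $\mathcal L_{rs}\not\subseteq\mathcal L_{\mathsf{iocos}}$; (3) $\mathcal L_{s}\not\supseteq\mathcal L_{\mathsf{iocos}}$; (4) $\mathcal L_{s}\not\subseteq\mathcal L_{\mathsf{iocos}}$.
   Context: Actions: disjoint finite sets $I$ (inputs $a?$) and $O$ (outputs $a!$, including quiescence $\delta!$), $L=I\cup O$. An LTS with inputs and outputs is $(S,I,O,\to)$ with $\to\subseteq S\times L\times S$ such that $p\xrightarrow{\delta!}p'$ iff $p=p'$ and $p$ has no $a!$-transition for $a!\in O\setminus\{\delta!\}$; LTSs are image-finite. For logics $\mathcal L,\mathcal L'$, "$\mathcal L\subseteq\mathcal L'$ up to logical equivalence" means every formula of $\mathcal L$ is satisfied by exactly the same states as some formula of $\mathcal L'$. Standard modalities: $p\models\langle a\rangle\phi$ iff some $a$-successor of $p$ satisfies $\phi$; $p\models[a]\phi$ iff every $a$-successor satisfies $\phi$. $\mathcal L_s$: $\phi::=\mathrm{ff}\mid\mathrm{tt}\mid\phi\wedge\phi\mid\phi\vee\phi\mid\langle a\rangle\phi$ ($a\in L$). $\mathcal L_{rs}$: $\phi::=\mathrm{ff}\mid\mathrm{tt}\mid\phi\wedge\phi\mid\phi\vee\phi\mid\langle a\rangle\phi\mid[a]\mathrm{ff}$ ($a\in L$). $\mathcal L_{\mathsf{iocos}}$: $\phi::=\mathrm{tt}\mid\mathrm{ff}\mid\phi\wedge\phi\mid\phi\vee\phi\mid\langle\!\langle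 a?\rangle\!\rangle\phi\mid\langle a!\rangle\phi$ ($a?\in I$, $a!\in O$), where $p\models\langle\!\langle a?\rangle\!\rangle\phi$ iff $p$ has no $a?$-transition or some $a?$-successor of $p$ satisfies $\phi$. -}

module Defs where

open import Data.Nat using (ℕ)
open import Data.Fin using (Fin)
open import Data.Sum using (_⊎_; inj₁; inj₂)
open import Data.Product using (Σ; ∃; _×_; _,_)
open import Data.Unit using (⊤)
open import Data.Empty using (⊥)
open import Data.List using (List; [])
open import Data.List.Membership.Propositional using (_∈_)
open import Relation.Binary.PropositionalEquality using (_≡_; _≢_)
open import Function.Bundles using (_⇔_)
open import Relation.Nullary using (¬_)

-- Action alphabet: inputs I = Fin nI, outputs O = Fin nO, with a
-- distinguished quiescence output δ : O.  L = I ⊎ O (disjoint union).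
module IO (nI nO : ℕ) (δ : Fin nO) where

  I : Set
  I = Fin nI

  O : Set
  O = Fin nO

  L : Set
  L = I ⊎ O

  inp : I → L
  inp = inj₁

  out : O → L
  out = inj₂

  -- An LTS with inputs and outputs.  The transition relation is given by
  -- finite successor lists, which builds in image-finiteness:
  --   p --a--> p'   iff   p' ∈ succ p a.
  record LTS : Set₁ where
    field
      State : Set
      succ  : State → L → List State
      quiescence : ∀ (p p' : State) →
        (p' ∈ succ p (out δ)) ⇔ ((p ≡ p') × (∀ (b : O) → b ≢ δ → succ p (out b) ≡ []))

  open LTS public

  _—[_]→_ : {T : LTS} → State T → L → State T → Set
  _—[_]→_ {T} p a p' = p' ∈ succ T p a

  data Fs : Set where
    ff tt : Fs
    _∧_ _∨_ : Fs → Fs → Fs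
    ⟨_⟩_ : L → Fs → Fs

  data Frs : Set where
    ff tt : Frs
    _∧_ _∨_ : Frs → Frs → Frs
    ⟨_⟩_ : L → Frs → Frs
    [_]ff : L → Frs

  data Fiocos : Set where
    ff tt : Fiocos
    _∧_ _∨_ : Fiocos → Fiocos → Fiocos
    ⟨⟨_⟩⟩_ : I → Fiocos → Fiocos
    ⟨_⟩_ : O → Fiocos → Fiocos

  sat-s : (T : LTS) → State T → Fs → Set
  sat-s T p ff = ⊥
  sat-s T p tt = ⊤
  sat-s T p (φ ∧ ψ) = sat-s T p φ × sat-s T p ψ
  sat-s T p (φ ∨ ψ) = sat-s T p φ ⊎ sat-s T p ψ
  sat-s T p (⟨ a ⟩ φ) = Σ (State T) λ p' → (_—[_]→_ {T} p a p') × sat-s T p' φ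

  sat-rs : (T : LTS) → State T → Frs → Set
  sat-rs T p ff = ⊥
  sat-rs T p tt = ⊤
  sat-rs T p (φ ∧ ψ) = sat-rs T p φ × sat-rs T p ψ
  sat-rs T p (φ ∨ ψ) = sat-rs T p φ ⊎ sat-rs T p ψ
  sat-rs T p (⟨ a ⟩ φ) = Σ (State T) λ p' → (_—[_]→_ {T} p a p') × sat-rs T p' φ
  sat-rs T p ([ a ]ff) = ∀ (p' : State T) → (_—[_]→_ {T} p a p') → ⊥

  sat-iocos : (T : LTS) → State T → Fiocos → Set
  sat-iocos T p ff = ⊥
  sat-iocos T p tt = ⊤
  sat-iocos T p (φ ∧ ψ) = sat-iocos T p φ × sat-iocos T p ψ
  sat-iocos T p (φ ∨ ψ) = sat-iocos T p φ ⊎ sat-iocos T p ψ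
  sat-iocos T p (⟨⟨ a ⟩⟩ φ) =
    (∀ (p' : State T) → ¬ (_—[_]→_ {T} p (inp a) p'))
    ⊎ (Σ (State T) λ p' → (_—[_]→_ {T} p (inp a) p') × sat-iocos T p' φ)
  sat-iocos T p (⟨ a ⟩ φ) = Σ (State T) λ p' → (_—[_]→_ {T} p (out a) p') × sat-iocos T p' φ

  _≅_via_,_ : {A B : Set} → A → B → ((T : LTS) → State T → A → Set)
                → ((T : LTS) → State T → B → Set) → Set₁
  φ ≅ ψ via satA , satB = ∀ (T : LTS) (p : State T) → satA T p φ ⇔ satB T p ψ

  Included : {A B : Set} → ((T : LTS) → State T → A → Set)
             → ((T : LTS) → State T → B → Set) → Set₁
  Included {A} {B} satA satB = ∀ (φ : A) → Σ B λ ψ → φ ≅ ψ via satA , satB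

-- ⟨⟨a?⟩⟩φ is expressible in 𝓛rs as [a?]ff ∨ ⟨a?⟩φ, which gives (1).  For the
-- non-inclusions take the two-state LTS in which `true` loops on every input
-- and on δ!, and `false` loops on δ! only.  Both states have the same outputs,
-- and `false` refuses all inputs, so every 𝓛iocos formula true at `true` is
-- true at `false`; conversely `true` simulates `false`, so every 𝓛s formula
-- true at `false` is true at `true`.  Then ⟨a?⟩tt (in 𝓛rs and in 𝓛s) holds at
-- `true` only, and ⟨⟨a?⟩⟩ff holds at `false` only.
module Submission where

open import Defs
open import Data.Nat using (ℕ)
open import Data.Fin using (Fin)
open import Data.Fin.Properties using (_≟_)
open import Data.Bool using (Bool; true; false)
open import Data.Product using (Σ; _×_; _,_; map₂)
open import Data.Product.Function.NonDependent.Propositional using (_×-⇔_)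
open import Data.Sum using (inj₁; inj₂)
open import Data.Sum.Function.Propositional using (_⊎-⇔_)
open import Data.Unit using (tt)
open import Data.Empty using (⊥-elim)
open import Data.List using (List; []; _∷_)
open import Data.List.Relation.Unary.Any using (here; there)
open import Data.List.Membership.Propositional using (_∈_)
open import Relation.Nullary using (¬_; yes; no)
open import Relation.Binary.PropositionalEquality using (_≡_; _≢_; refl)
open import Function.Bundles using (_⇔_; mk⇔; Equivalence)
open import Function.Construct.Identity using (⇔-id)

module _ {nI nO : ℕ} {δ : Fin nO} where
  open IO nI nO δ

  ◇-⇔ : {S : Set} {R P Q : S → Set} → (∀ s → P s ⇔ Q s) →
        Σ S (λ s → R s × P s) ⇔ Σ S (λ s → R s × Q s)
  ◇-⇔ P⇔Q = mk⇔ (map₂ (map₂ (Equivalence.to (P⇔Q _))))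
                (map₂ (map₂ (Equivalence.from (P⇔Q _))))

  iocos⇒rs : Fiocos → Frs
  iocos⇒rs ff          = ff
  iocos⇒rs tt          = tt
  iocos⇒rs (φ ∧ ψ)     = iocos⇒rs φ ∧ iocos⇒rs ψ
  iocos⇒rs (φ ∨ ψ)     = iocos⇒rs φ ∨ iocos⇒rs ψ
  iocos⇒rs (⟨⟨ a ⟩⟩ φ) = [ inp a ]ff ∨ (⟨ inp a ⟩ iocos⇒rs φ)
  iocos⇒rs (⟨ b ⟩ φ)   = ⟨ out b ⟩ iocos⇒rs φ

  iocos⇒rs-≅ : ∀ φ → φ ≅ iocos⇒rs φ via sat-iocos , sat-rs
  iocos⇒rs-≅ ff          T p = ⇔-id _
  iocos⇒rs-≅ tt          T p = ⇔-id _
  iocos⇒rs-≅ (φ ∧ ψ)     T p = iocos⇒rs-≅ φ T p ×-⇔ iocos⇒rs-≅ ψ T p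
  iocos⇒rs-≅ (φ ∨ ψ)     T p = iocos⇒rs-≅ φ T p ⊎-⇔ iocos⇒rs-≅ ψ T p
  iocos⇒rs-≅ (⟨⟨ a ⟩⟩ φ) T p = ⇔-id _ ⊎-⇔ ◇-⇔ (λ p' → iocos⇒rs-≅ φ T p')
  iocos⇒rs-≅ (⟨ b ⟩ φ)   T p = ◇-⇔ (λ p' → iocos⇒rs-≅ φ T p')

  iocos⊆rs : Included sat-iocos sat-rs
  iocos⊆rs φ = iocos⇒rs φ , iocos⇒rs-≅ φ

  preserved⇒¬Included :
    {A B : Set} {satA : (T : LTS) → State T → A → Set}
    {satB : (T : LTS) → State T → B → Set} (T : LTS) {p q : State T} →
    (∀ ψ → satB T p ψ → satB T q ψ) →
    (φ : A) → satA T p φ → ¬ satA T q φ → ¬ Included satA satB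
  preserved⇒¬Included T pres φ pφ ¬qφ inc with inc φ
  ... | ψ , φ≅ψ =
    ¬qφ (Equivalence.from (φ≅ψ T _) (pres ψ (Equivalence.to (φ≅ψ T _) pφ)))

  δ-loop : Bool → O → List Bool
  δ-loop s b with b ≟ δ
  ... | yes _ = s ∷ []
  ... | no  _ = []

  ∈-δ-loop : ∀ {s s' b} → s' ∈ δ-loop s b → b ≡ δ × s' ≡ s
  ∈-δ-loop {b = b} s'∈ with b ≟ δ
  ∈-δ-loop (here s'≡s) | yes b≡δ = b≡δ , s'≡s
  ∈-δ-loop (there ())  | yes _

  δ-loop-δ : ∀ s → s ∈ δ-loop s δ
  δ-loop-δ s with δ ≟ δ
  ... | yes _   = here refl
  ... | no  δ≢δ = ⊥-elim (δ≢δ refl)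

  δ-loop-¬δ : ∀ s b → b ≢ δ → δ-loop s b ≡ []
  δ-loop-¬δ s b b≢δ with b ≟ δ
  ... | yes b≡δ = ⊥-elim (b≢δ b≡δ)
  ... | no  _   = refl

  inputLoop-succ : Bool → L → List Bool
  inputLoop-succ s     (inj₂ b) = δ-loop s b
  inputLoop-succ true  (inj₁ _) = true ∷ []
  inputLoop-succ false (inj₁ _) = []

  δ-loop-quiescence : ∀ s s' →
    s' ∈ δ-loop s δ ⇔ (s ≡ s' × ∀ b → b ≢ δ → δ-loop s b ≡ [])
  δ-loop-quiescence s s' = mk⇔ to (λ { (refl , _) → δ-loop-δ s })
    where
    to : s' ∈ δ-loop s δ → s ≡ s' × ∀ b → b ≢ δ → δ-loop s b ≡ []
    to s'∈ with ∈-δ-loop s'∈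
    ... | _ , refl = refl , δ-loop-¬δ s

  inputLoop : LTS
  inputLoop = record
    { State      = Bool
    ; succ       = inputLoop-succ
    ; quiescence = δ-loop-quiescence
    }

  iocos-true⇒false : ∀ φ → sat-iocos inputLoop true φ → sat-iocos inputLoop false φ
  iocos-true⇒false tt          _        = tt
  iocos-true⇒false (φ ∧ ψ)     (x , y)  = iocos-true⇒false φ x , iocos-true⇒false ψ y
  iocos-true⇒false (φ ∨ ψ)     (inj₁ x) = inj₁ (iocos-true⇒false φ x)
  iocos-true⇒false (φ ∨ ψ)     (inj₂ y) = inj₂ (iocos-true⇒false ψ y)
  iocos-true⇒false (⟨⟨ a ⟩⟩ φ) _        = inj₁ λ _ ()
  iocos-true⇒false (⟨ b ⟩ φ)   (_ , s∈ , x) with ∈-δ-loop s∈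
  ... | refl , refl = false , δ-loop-δ false , iocos-true⇒false φ x

  s-false⇒true : ∀ φ → sat-s inputLoop false φ → sat-s inputLoop true φ
  s-false⇒true tt              _        = tt
  s-false⇒true (φ ∧ ψ)         (x , y)  = s-false⇒true φ x , s-false⇒true ψ y
  s-false⇒true (φ ∨ ψ)         (inj₁ x) = inj₁ (s-false⇒true φ x)
  s-false⇒true (φ ∨ ψ)         (inj₂ y) = inj₂ (s-false⇒true ψ y)
  s-false⇒true (⟨ inj₁ a ⟩ φ)  (_ , () , _)
  s-false⇒true (⟨ inj₂ b ⟩ φ)  (_ , s∈ , x) with ∈-δ-loop s∈
  ... | refl , refl = true , δ-loop-δ true , s-false⇒true φ x

  rs⊈iocos : I → ¬ Included sat-rs sat-iocos
  rs⊈iocos a = preserved⇒¬Included inputLoop iocos-true⇒false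
    (⟨ inp a ⟩ tt) (true , here refl , tt) λ { (_ , () , _) }

  iocos⊈s : I → ¬ Included sat-iocos sat-s
  iocos⊈s a = preserved⇒¬Included inputLoop s-false⇒true
    (⟨⟨ a ⟩⟩ ff) (inj₁ λ _ ()) λ { (inj₁ ¬t) → ¬t true (here refl)
                                 ; (inj₂ (_ , _ , ())) }

  s⊈iocos : I → ¬ Included sat-s sat-iocos
  s⊈iocos a = preserved⇒¬Included inputLoop iocos-true⇒false
    (⟨ inp a ⟩ tt) (true , here refl , tt) λ { (_ , () , _) }

proposition3 : (nI nO : ℕ) (δ : Fin nO) →
    let open IO nI nO δ in
      Included sat-iocos sat-rs
      × (I → ¬ Included sat-rs sat-iocos
             × ¬ Included sat-iocos sat-s
             × ¬ Included sat-s sat-iocos)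
proposition3 nI nO δ = iocos⊆rs , λ a → rs⊈iocos a , iocos⊈s a , s⊈iocos a
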